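{- If $p \equiv 1 \pmod 4$ is prime and $4$ divides the multiplicative order of $k$ in $\mathbb{Z}_p^*$, then there is a factorisation of $K_p$ into $\mathrm{Cay}(\mathbb{Z}_p; \pm\{1, k\})$.
   Context: For a group $G$ and a subset $S \subseteq G$ not containing the identity and closed under inverses, the Cayley graph $\mathrm{Cay}(G;S)$ has vertex set $G$, with $g$ adjacent to $g s$ for each $g\in G$, $s \in S$. $\pm\{a_1,\dots,a_s\}$ denotes $\{\pm a_1,\dots,\pm a_s\}$. A factorisation of a graph into $H$ is a decomposition of its edge set into edge-disjoint spanning subgraphs each isomorphic to $H$. $\mathbb{Z}_p^*$ is the multiplicative group of units modulo $p$. -}

module Defs where

open import Level using (Level; 0ℓ) renaming (suc to lsuc)
open import Data.Nat using (ℕ; zero; suc; _+_; _*_; _∸_; _^_; _<_; NonZero)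
open import Data.Nat.DivMod using (_%_)
open import Data.Nat.Divisibility using (_∣_)
open import Data.Fin using (Fin; toℕ)
open import Data.Sum using (_⊎_)
open import Data.Product using (Σ; _×_; ∃; ∃-syntax; _,_)
open import Relation.Nullary using (¬_)
open import Relation.Binary.PropositionalEquality using (_≡_)
open import Function.Bundles using (_⤖_; Bijection; _⇔_)

Graph : Set → Set₁
Graph V = V → V → Set

_≅_ : {V W : Set} → Graph V → Graph W → Set
_≅_ {V} {W} G H = Σ (V ⤖ W) λ f →
  ∀ x y → G x y ⇔ H (Bijection.to f x) (Bijection.to f y)

_⊆ᴳ_ : {V : Set} → Graph V → Graph V → Set
_⊆ᴳ_ {V} E G = ∀ x y → E x y → G x y

-- A factorisation of G into H: a family of edge-disjoint spanning subgraphs of G,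
-- each isomorphic to H, whose edge sets together cover all edges of G
-- (every edge of G lies in exactly one factor).
Factorisation : {V W : Set} → Graph V → Graph W → Set₁
Factorisation {V} G H =
  Σ ℕ λ m → Σ (Fin m → Graph V) λ E →
    (∀ i → E i ⊆ᴳ G) ×
    (∀ i → E i ≅ H) ×
    (∀ x y → G x y → ∃[ i ] (E i x y × (∀ j → E j x y → j ≡ i)))

K : (n : ℕ) → Graph (Fin n)
K n x y = ¬ (x ≡ y)

-- Residue of y - x in ℤ_n, as a natural number in [0, n).
diff : (n : ℕ) → .{{_ : NonZero n}} → Fin n → Fin n → ℕ
diff n x y = (toℕ y + (n ∸ toℕ x)) % n

-- Cayley graph Cay(ℤ_n; S), S given as a predicate on residues in [0, n):
-- g adjacent to g + s for s ∈ S, i.e. x ~ y iff y - x ∈ S.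
Cay : (n : ℕ) → .{{_ : NonZero n}} → (ℕ → Set) → Graph (Fin n)
Cay n S x y = S (diff n x y)

pm2 : (n : ℕ) → .{{_ : NonZero n}} → ℕ → ℕ → ℕ → Set
pm2 n a b d =
  d ≡ a % n ⊎ d ≡ (n ∸ a % n) % n ⊎ d ≡ b % n ⊎ d ≡ (n ∸ b % n) % n

IsMultOrder : (p : ℕ) → .{{_ : NonZero p}} → ℕ → ℕ → Set
IsMultOrder p k ord =
  0 < ord × (k ^ ord) % p ≡ 1 % p × (∀ m → 0 < m → m < ord → ¬ ((k ^ m) % p ≡ 1 % p))

module Submission where

-- Let n be the order of k and H = ⟨k⟩ ≤ ℤ_p^*, so k^(n/2) = −1 and S = ±{1, k} = k^J with
-- J = {0, 1, n/2, n/2 + 1}.  For c ≠ 0 the graph x ~ y ⟺ c (y − x) ∈ S is the image of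
-- Cay(ℤ_p; S) under x ↦ c⁻¹ x.  Take the least element of each coset of H as its base point
-- and let minExp c be the exponent with c k^(minExp c) the base point of cH; then
-- minExp (c k^j) ≡ minExp c − j (mod n).  As 4 ∣ n, the even residues R below n/2 satisfy
-- J + R = ℤ_n, so for every d ≠ 0 exactly one c with minExp c ∈ R has c d ∈ S.  These c
-- index the factors.

open import Defs
open import Data.Nat using (ℕ; NonZero)
open import Data.Nat.DivMod using (_%_)
open import Data.Nat.Divisibility using (_∣_)
open import Data.Nat.Primality using (Prime)
open import Data.Product using (_×_)
open import Relation.Binary.PropositionalEquality using (_≡_)

open import Level using (0ℓ)
open import Data.Nat.Base
open import Data.Nat.Properties
open import Data.Nat.DivMod
open import Data.Nat.Divisibility using (divides; m%n≡0⇒n∣m; n∣m⇒m%n≡0; ∣⇒≤)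
open import Data.Nat.Primality using (euclidsLemma; prime⇒nonTrivial)
open import Data.Nat.Coprimality using (prime⇒coprime; coprime-Bézout)
open import Data.Nat.GCD using (module Bézout)
open import Data.Nat.Tactic.RingSolver using (solve-∀)
open import Data.Fin.Base using (Fin; toℕ; fromℕ<; zero; suc)
open import Data.Fin.Properties using (toℕ-injective; toℕ-fromℕ<; toℕ<n)
open import Data.Product using (∃-syntax; ∃₂; _,_; proj₁; proj₂)
import Data.Product as Product
open import Data.Sum using (_⊎_; inj₁; inj₂)
open import Data.Empty using (⊥-elim)
open import Data.List.Base using (List; upTo; filter; length; lookup)
import Data.List.Relation.Unary.All as All
open import Data.List.Relation.Unary.Any using (index)
open import Data.List.Relation.Unary.Any.Properties using (lookup-index)
open import Data.List.Relation.Unary.AllPairs using (_∷_)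
open import Data.List.Relation.Unary.Unique.Propositional using (Unique)
open import Data.List.Relation.Unary.Unique.Propositional.Properties using (upTo⁺; filter⁺)
open import Data.List.Membership.Propositional using (_∈_)
open import Data.List.Membership.Propositional.Properties
  using (∈-upTo⁺; ∈-upTo⁻; ∈-lookup; ∈-filter⁺; ∈-filter⁻)
open import Data.List.Extrema.Nat using (argmin; argmin-all; f[argmin]≤f[xs])
open import Function.Base using (_∘_)
open import Function.Bundles using (_⇔_; mk⇔; mk↔ₛ′; module Equivalence)
open import Function.Properties.Equivalence using () renaming (trans to ⇔-trans)
open import Function.Properties.Inverse using (↔⇒⤖)
open import Relation.Binary.Bundles using (Setoid)
open import Relation.Binary.Definitions using (_Respects_; tri<; tri≈; tri>)
import Relation.Binary.Construct.On as On
import Relation.Binary.Reasoning.Setoid as SetoidReasoning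
open import Relation.Binary.PropositionalEquality as ≡ using (refl; cong; cong₂)
open import Relation.Nullary using (¬_)
open import Relation.Nullary.Decidable using (_×-dec_)
open import Relation.Unary using (Decidable)

m+[n+[o∸m]]≡n+o : ∀ {m n o} → m ≤ o → m + (n + (o ∸ m)) ≡ n + o
m+[n+[o∸m]]≡n+o {m} {n} {o} m≤o = begin
  m + (n + (o ∸ m))   ≡⟨ cong (m +_) (+-comm n (o ∸ m)) ⟩
  m + (o ∸ m + n)     ≡⟨ +-assoc m (o ∸ m) n ⟨
  m + (o ∸ m) + n     ≡⟨ cong (_+ n) (m+[n∸m]≡n m≤o) ⟩
  o + n               ≡⟨ +-comm o n ⟩
  n + o               ∎
  where open ≡.≡-Reasoning

regroup-digits : ∀ t e f s → e + f * (t * 2) + s * 2 ≡ e + (s + f * t) * 2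
regroup-digits = solve-∀

4t≡[2t]2 : ∀ t → t * 4 ≡ 2 * t * 2
4t≡[2t]2 = solve-∀

[2+b]b+1≡[1+b]² : ∀ b → (2 + b) * b + 1 ≡ suc b * suc b
[2+b]b+1≡[1+b]² = solve-∀

4t≡2t+2t : ∀ t → t * 4 ≡ t * 2 + t * 2
4t≡2t+2t = solve-∀

lookup-injective : ∀ {A : Set} {xs : List A} → Unique xs → ∀ i j → lookup xs i ≡ lookup xs j → i ≡ j
lookup-injective (_ ∷ _)      zero    zero    _  = refl
lookup-injective (x∉xs ∷ _)   zero    (suc j) eq = ⊥-elim (All.lookup x∉xs (∈-lookup j) eq)
lookup-injective (x∉xs ∷ _)   (suc i) zero    eq = ⊥-elim (All.lookup x∉xs (∈-lookup i) (≡.sym eq))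
lookup-injective (_ ∷ unique) (suc i) (suc j) eq = cong suc (lookup-injective unique i j eq)

module Residues (p : ℕ) .{{_ : NonZero p}} where

  infix 4 _≈_
  _≈_ : ℕ → ℕ → Set
  a ≈ b = a % p ≡ b % p

  ≈-setoid : Setoid 0ℓ 0ℓ
  ≈-setoid = record
    { Carrier = ℕ ; _≈_ = _≈_ ; isEquivalence = On.isEquivalence (_% p) ≡.isEquivalence }

  module ≈-Reasoning = SetoidReasoning ≈-setoid

  ≡⇒≈ : ∀ {a b} → a ≡ b → a ≈ b
  ≡⇒≈ = cong (_% p)

  %-≈ : ∀ a → a % p ≈ a
  %-≈ a = m%n%n≡m%n a p

  ≈⇒≡ : ∀ {a b} → a < p → b < p → a ≈ b → a ≡ b
  ≈⇒≡ a<p b<p a≈b = ≡.trans (≡.sym (m<n⇒m%n≡m a<p)) (≡.trans a≈b (m<n⇒m%n≡m b<p))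

  ≈0⇒≡0 : ∀ {a} → a < p → a ≈ 0 → a ≡ 0
  ≈0⇒≡0 a<p = ≈⇒≡ a<p (>-nonZero⁻¹ p)

  0<a<p⇒≉0 : ∀ {a} → 0 < a → a < p → ¬ a ≈ 0
  0<a<p⇒≉0 0<a a<p a≈0 = <⇒≢ 0<a (≡.sym (≈0⇒≡0 a<p a≈0))

  ≡%⇔≈ : ∀ {d a} → d < p → (d ≡ a % p) ⇔ (d ≈ a)
  ≡%⇔≈ d<p = mk⇔ (≡.trans (m<n⇒m%n≡m d<p)) (≡.trans (≡.sym (m<n⇒m%n≡m d<p)))

  +-cong : ∀ {a b c d} → a ≈ b → c ≈ d → a + c ≈ b + d
  +-cong {a} {b} {c} {d} a≈b c≈d = begin
    (a + c) % p             ≡⟨ %-distribˡ-+ a c p ⟩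
    (a % p + c % p) % p     ≡⟨ cong₂ (λ x y → (x + y) % p) a≈b c≈d ⟩
    (b % p + d % p) % p     ≡⟨ %-distribˡ-+ b d p ⟨
    (b + d) % p             ∎
    where open ≡.≡-Reasoning

  *-cong : ∀ {a b c d} → a ≈ b → c ≈ d → a * c ≈ b * d
  *-cong {a} {b} {c} {d} a≈b c≈d = begin
    (a * c) % p             ≡⟨ %-distribˡ-* a c p ⟩
    (a % p * (c % p)) % p   ≡⟨ cong₂ (λ x y → (x * y) % p) a≈b c≈d ⟩
    (b % p * (d % p)) % p   ≡⟨ %-distribˡ-* b d p ⟨
    (b * d) % p             ∎
    where open ≡.≡-Reasoning

  +-congˡ : ∀ {a b c} → b ≈ c → a + b ≈ a + c
  +-congˡ {a} = +-cong {a} refl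

  +-congʳ : ∀ {a b c} → b ≈ c → b + a ≈ c + a
  +-congʳ b≈c = +-cong b≈c refl

  *-congˡ : ∀ {a b c} → b ≈ c → a * b ≈ a * c
  *-congˡ {a} = *-cong {a} refl

  *-congʳ : ∀ {a b c} → b ≈ c → b * a ≈ c * a
  *-congʳ b≈c = *-cong b≈c refl

  0%p≡0 : 0 % p ≡ 0
  0%p≡0 = m<n⇒m%n≡m (>-nonZero⁻¹ p)

  m*p≈0 : ∀ m → m * p ≈ 0
  m*p≈0 m = ≡.trans (m*n%n≡0 m p) (≡.sym 0%p≡0)

  p≈0 : p ≈ 0
  p≈0 = ≡.trans (≡⇒≈ (≡.sym (*-identityˡ p))) (m*p≈0 1)

  ^-≈1 : ∀ {a} → a ≈ 1 → ∀ e → a ^ e ≈ 1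
  ^-≈1 a≈1 zero    = refl
  ^-≈1 a≈1 (suc e) = *-cong a≈1 (^-≈1 a≈1 e)

  -- The same negation as in pm2.
  neg : ℕ → ℕ
  neg a = p ∸ a % p

  neg-inverseˡ : ∀ a → neg a + a ≈ 0
  neg-inverseˡ a = begin
    neg a + a        ≈⟨ +-congˡ (%-≈ a) ⟨
    neg a + a % p    ≡⟨ m∸n+n≡m (m%n≤n a p) ⟩
    p                ≈⟨ p≈0 ⟩
    0                ∎
    where open ≈-Reasoning

  +-cancelʳ : ∀ a {b c} → b + a ≈ c + a → b ≈ c
  +-cancelʳ a {b} {c} b+a≈c+a = begin
    b                  ≡⟨ +-identityʳ b ⟨
    b + 0              ≈⟨ +-congˡ (neg-inverseˡ a) ⟨
    b + (neg a + a)    ≡⟨ cong (b +_) (+-comm (neg a) a) ⟩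
    b + (a + neg a)    ≡⟨ +-assoc b a (neg a) ⟨
    b + a + neg a      ≈⟨ +-congʳ b+a≈c+a ⟩
    c + a + neg a      ≡⟨ +-assoc c a (neg a) ⟩
    c + (a + neg a)    ≡⟨ cong (c +_) (+-comm a (neg a)) ⟩
    c + (neg a + a)    ≈⟨ +-congˡ (neg-inverseˡ a) ⟩
    c + 0              ≡⟨ +-identityʳ c ⟩
    c                  ∎
    where open ≈-Reasoning

  +-cancelˡ : ∀ a {b c} → a + b ≈ a + c → b ≈ c
  +-cancelˡ a {b} {c} a+b≈a+c =
    +-cancelʳ a (≡.trans (≡⇒≈ (+-comm b a)) (≡.trans a+b≈a+c (≡⇒≈ (+-comm a c))))

  neg-unique : ∀ {a b} → a + b ≈ 0 → a ≈ neg b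
  neg-unique {a} {b} a+b≈0 = +-cancelʳ b (≡.trans a+b≈0 (≡.sym (neg-inverseˡ b)))

  neg-*ˡ : ∀ a b → neg a * b ≈ neg (a * b)
  neg-*ˡ a b = neg-unique (begin
    neg a * b + a * b     ≡⟨ *-distribʳ-+ b (neg a) a ⟨
    (neg a + a) * b       ≈⟨ *-congʳ (neg-inverseˡ a) ⟩
    0                     ∎)
    where open ≈-Reasoning

  *-cancelˡ : ∀ {u u'} → u' * u ≈ 1 → ∀ {a b} → u * a ≈ u * b → a ≈ b
  *-cancelˡ {u} {u'} u'u≈1 {a} {b} ua≈ub = begin
    a              ≡⟨ *-identityˡ a ⟨
    1 * a          ≈⟨ *-congʳ u'u≈1 ⟨
    u' * u * a     ≡⟨ *-assoc u' u a ⟩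
    u' * (u * a)   ≈⟨ *-congˡ {u'} ua≈ub ⟩
    u' * (u * b)   ≡⟨ *-assoc u' u b ⟨
    u' * u * b     ≈⟨ *-congʳ u'u≈1 ⟩
    1 * b          ≡⟨ *-identityˡ b ⟩
    b              ∎
    where open ≈-Reasoning

  diff<p : ∀ x y → diff p x y < p
  diff<p x y = m%n<n _ p

  diff-+ : ∀ x y → diff p x y + toℕ x ≈ toℕ y
  diff-+ x y = begin
    (toℕ y + (p ∸ toℕ x)) % p + toℕ x   ≈⟨ +-congʳ (%-≈ (toℕ y + (p ∸ toℕ x))) ⟩
    toℕ y + (p ∸ toℕ x) + toℕ x         ≡⟨ +-assoc (toℕ y) (p ∸ toℕ x) (toℕ x) ⟩
    toℕ y + (p ∸ toℕ x + toℕ x)         ≡⟨ cong (toℕ y +_) (m∸n+n≡m (<⇒≤ (toℕ<n x))) ⟩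
    toℕ y + p                           ≈⟨ +-congˡ p≈0 ⟩
    toℕ y + 0                           ≡⟨ +-identityʳ (toℕ y) ⟩
    toℕ y                               ∎
    where open ≈-Reasoning

  diff-unique : ∀ {d} x y → d + toℕ x ≈ toℕ y → d ≈ diff p x y
  diff-unique x y d+x≈y = +-cancelʳ (toℕ x) (≡.trans d+x≈y (≡.sym (diff-+ x y)))

  diff-self : ∀ x → diff p x x ≈ 0
  diff-self x = ≡.sym (diff-unique x x refl)

  diff≈0⇒≡ : ∀ x y → diff p x y ≈ 0 → x ≡ y
  diff≈0⇒≡ x y diff≈0 = toℕ-injective
    (≈⇒≡ (toℕ<n x) (toℕ<n y) (≡.trans (≡.sym (+-congʳ {toℕ x} diff≈0)) (diff-+ x y)))

  fin : ℕ → Fin p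
  fin a = fromℕ< (m%n<n a p)

  toℕ-fin : ∀ a → toℕ (fin a) ≈ a
  toℕ-fin a = ≡.trans (≡⇒≈ (toℕ-fromℕ< (m%n<n a p))) (%-≈ a)

  scale : ℕ → Fin p → Fin p
  scale c x = fin (c * toℕ x)

  scale-inverse : ∀ {c c'} → c' * c ≈ 1 → ∀ x → scale c' (scale c x) ≡ x
  scale-inverse {c} {c'} c'c≈1 x = toℕ-injective (≈⇒≡ (toℕ<n _) (toℕ<n x) (begin
    toℕ (scale c' (scale c x))   ≈⟨ toℕ-fin _ ⟩
    c' * toℕ (scale c x)         ≈⟨ *-congˡ {c'} (toℕ-fin _) ⟩
    c' * (c * toℕ x)             ≡⟨ *-assoc c' c (toℕ x) ⟨
    c' * c * toℕ x               ≈⟨ *-congʳ c'c≈1 ⟩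
    1 * toℕ x                    ≡⟨ *-identityˡ (toℕ x) ⟩
    toℕ x                        ∎))
    where open ≈-Reasoning

  diff-scale : ∀ c x y → diff p (scale c x) (scale c y) ≈ c * diff p x y
  diff-scale c x y = ≡.sym (diff-unique (scale c x) (scale c y) (begin
    c * diff p x y + toℕ (scale c x)   ≈⟨ +-congˡ (toℕ-fin _) ⟩
    c * diff p x y + c * toℕ x         ≡⟨ *-distribˡ-+ c (diff p x y) (toℕ x) ⟨
    c * (diff p x y + toℕ x)           ≈⟨ *-congˡ {c} (diff-+ x y) ⟩
    c * toℕ y                          ≈⟨ toℕ-fin _ ⟨
    toℕ (scale c y)                    ∎))
    where open ≈-Reasoning

  scale-≅ : ∀ {c c'} → c' * c ≈ 1 → {S : ℕ → Set} → S Respects _≈_ →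
            Cay p (λ d → S (c * d)) ≅ Cay p S
  scale-≅ {c} {c'} c'c≈1 resp =
    ↔⇒⤖ (mk↔ₛ′ (scale c) (scale c') (scale-inverse {c'} {c} cc'≈1) (scale-inverse {c} {c'} c'c≈1)) ,
    λ x y → mk⇔ (resp (≡.sym (diff-scale c x y))) (resp (diff-scale c x y))
    where
    cc'≈1 : c * c' ≈ 1
    cc'≈1 = ≡.trans (≡⇒≈ (*-comm c c')) c'c≈1

module PrimeResidues (p : ℕ) .{{_ : NonZero p}} (p-prime : Prime p) where

  open Residues p

  ≈0⇒∣ : ∀ {a} → a ≈ 0 → p ∣ a
  ≈0⇒∣ {a} a≈0 = m%n≡0⇒n∣m a p (≡.trans a≈0 0%p≡0)

  ∣⇒≈0 : ∀ {a} → p ∣ a → a ≈ 0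
  ∣⇒≈0 {a} p∣a = ≡.trans (n∣m⇒m%n≡0 a p p∣a) (≡.sym 0%p≡0)

  1≉0 : ¬ 1 ≈ 0
  1≉0 1≈0 = <⇒≱ (nonTrivial⇒n>1 p) (∣⇒≤ (≈0⇒∣ 1≈0))
    where instance _ = prime⇒nonTrivial p-prime

  invertible⇒≉0 : ∀ {w a} → w * a ≈ 1 → ¬ a ≈ 0
  invertible⇒≉0 {w} {a} wa≈1 a≈0 = 1≉0 (begin
    1        ≈⟨ wa≈1 ⟨
    w * a    ≈⟨ *-congˡ {w} a≈0 ⟩
    w * 0    ≡⟨ *-zeroʳ w ⟩
    0        ∎)
    where open ≈-Reasoning

  inverse : ∀ {a} → ¬ a ≈ 0 → ∃[ w ] w * a ≈ 1
  inverse {a} a≉0 with coprime-Bézout (prime⇒coprime p-prime (m%n<n a p))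
    where instance _ = ≢-nonZero (a≉0 ∘ λ a%p≡0 → ≡.trans a%p≡0 (≡.sym 0%p≡0))
  ... | Bézout.-+ x y eq = y , (begin
    y * a              ≈⟨ *-congˡ {y} (%-≈ a) ⟨
    y * (a % p)        ≡⟨ eq ⟨
    1 + x * p          ≈⟨ +-congˡ (m*p≈0 x) ⟩
    1 + 0              ∎)
    where open ≈-Reasoning
  ... | Bézout.+- x y eq = neg y , (begin
    neg y * a          ≈⟨ neg-*ˡ y a ⟩
    neg (y * a)        ≈⟨ neg-unique 1+ya≈0 ⟨
    1                  ∎)
    where
    open ≈-Reasoning
    1+ya≈0 : 1 + y * a ≈ 0
    1+ya≈0 = begin
      1 + y * a        ≈⟨ +-congˡ (*-congˡ {y} (%-≈ a)) ⟨
      1 + y * (a % p)  ≡⟨ eq ⟩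
      x * p            ≈⟨ m*p≈0 x ⟩
      0                ∎

  square≈1⇒±1 : ∀ a → a * a ≈ 1 → a ≈ 1 ⊎ a ≈ neg 1
  square≈1⇒±1 zero 0≈1 = ⊥-elim (1≉0 (≡.sym 0≈1))
  square≈1⇒±1 (suc b) a²≈1 with euclidsLemma (2 + b) b p-prime (≈0⇒∣ [2+b]b≈0)
    where
    [2+b]b≈0 : (2 + b) * b ≈ 0
    [2+b]b≈0 = +-cancelʳ 1 (≡.trans (≡⇒≈ ([2+b]b+1≡[1+b]² b)) a²≈1)
  ... | inj₁ p∣2+b = inj₂ (neg-unique (≡.trans (≡⇒≈ (+-comm (suc b) 1)) (∣⇒≈0 p∣2+b)))
  ... | inj₂ p∣b = inj₁ (+-congˡ {1} (∣⇒≈0 p∣b))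

module CyclicSubgroup (p : ℕ) .{{_ : NonZero p}} (p-prime : Prime p)
                      (k n : ℕ) (order : IsMultOrder p k n) where

  open Residues p
  open PrimeResidues p p-prime

  private
    0<n : 0 < n
    0<n = proj₁ order

    k^n≈1 : k ^ n ≈ 1
    k^n≈1 = proj₁ (proj₂ order)

    minimal : ∀ m → 0 < m → m < n → ¬ k ^ m ≈ 1
    minimal = proj₂ (proj₂ order)

  instance
    n-nonZero : NonZero n
    n-nonZero = >-nonZero 0<n

  *-^-+ : ∀ w a b → w * k ^ a * k ^ b ≡ w * k ^ (a + b)
  *-^-+ w a b = ≡.trans (*-assoc w (k ^ a) (k ^ b)) (cong (w *_) (≡.sym (^-distribˡ-+-* k a b)))

  ^-+n : ∀ a → k ^ (a + n) ≈ k ^ a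
  ^-+n a = begin
    k ^ (a + n)        ≡⟨ ^-distribˡ-+-* k a n ⟩
    k ^ a * k ^ n      ≈⟨ *-congˡ {k ^ a} k^n≈1 ⟩
    k ^ a * 1          ≡⟨ *-identityʳ (k ^ a) ⟩
    k ^ a              ∎
    where open ≈-Reasoning

  ^-%n : ∀ a → k ^ a ≈ k ^ (a % n)
  ^-%n a = begin
    k ^ a                          ≡⟨ cong (k ^_) (m≡m%n+[m/n]*n a n) ⟩
    k ^ (a % n + a / n * n)        ≡⟨ ^-distribˡ-+-* k (a % n) (a / n * n) ⟩
    k ^ (a % n) * k ^ (a / n * n)  ≡⟨ cong (λ e → k ^ (a % n) * k ^ e) (*-comm (a / n) n) ⟩
    k ^ (a % n) * k ^ (n * (a / n)) ≡⟨ cong (k ^ (a % n) *_) (^-*-assoc k n (a / n)) ⟨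
    k ^ (a % n) * (k ^ n) ^ (a / n) ≈⟨ *-congˡ {k ^ (a % n)} (^-≈1 k^n≈1 (a / n)) ⟩
    k ^ (a % n) * 1                ≡⟨ *-identityʳ (k ^ (a % n)) ⟩
    k ^ (a % n)                    ∎
    where open ≈-Reasoning

  ^-inverse : ∀ {a} → a ≤ n → k ^ (n ∸ a) * k ^ a ≈ 1
  ^-inverse {a} a≤n =
    ≡.trans (≡⇒≈ (≡.trans (≡.sym (^-distribˡ-+-* k (n ∸ a) a)) (cong (k ^_) (m∸n+n≡m a≤n)))) k^n≈1

  ^≉0 : ∀ a → ¬ k ^ a ≈ 0
  ^≉0 a = invertible⇒≉0 {k ^ (n ∸ a % n)} (begin
    k ^ (n ∸ a % n) * k ^ a         ≈⟨ *-congˡ {k ^ (n ∸ a % n)} (^-%n a) ⟩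
    k ^ (n ∸ a % n) * k ^ (a % n)   ≈⟨ ^-inverse (m%n≤n a n) ⟩
    1                               ∎)
    where open ≈-Reasoning

  private
    ^-distinct : ∀ {a b} → a < b → b < n → ¬ k ^ a ≈ k ^ b
    ^-distinct {a} {b} a<b b<n k^a≈k^b = minimal (b ∸ a) (m<n⇒0<n∸m a<b) (≤-<-trans (m∸n≤m b a) b<n)
      (*-cancelˡ {k ^ a} {k ^ (n ∸ a)} (^-inverse (<⇒≤ (<-trans a<b b<n))) (begin
        k ^ a * k ^ (b ∸ a)     ≡⟨ ^-distribˡ-+-* k a (b ∸ a) ⟨
        k ^ (a + (b ∸ a))       ≡⟨ cong (k ^_) (m+[n∸m]≡n (<⇒≤ a<b)) ⟩
        k ^ b                   ≈⟨ k^a≈k^b ⟨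
        k ^ a                   ≡⟨ *-identityʳ (k ^ a) ⟨
        k ^ a * 1               ∎))
      where open ≈-Reasoning

  ^-injective : ∀ {a b} → a < n → b < n → k ^ a ≈ k ^ b → a ≡ b
  ^-injective {a} {b} a<n b<n k^a≈k^b with <-cmp a b
  ... | tri< a<b _ _ = ⊥-elim (^-distinct a<b b<n k^a≈k^b)
  ... | tri≈ _ a≡b _ = a≡b
  ... | tri> _ _ b<a = ⊥-elim (^-distinct b<a a<n (≡.sym k^a≈k^b))

  ^-half≈-1 : ∀ h → n ≡ h + h → k ^ h ≈ neg 1
  ^-half≈-1 h n≡h+h with square≈1⇒±1 (k ^ h) k^h*k^h≈1
    where
    k^h*k^h≈1 : k ^ h * k ^ h ≈ 1
    k^h*k^h≈1 =
      ≡.trans (≡⇒≈ (≡.trans (≡.sym (^-distribˡ-+-* k h h)) (cong (k ^_) (≡.sym n≡h+h)))) k^n≈1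
  ... | inj₂ k^h≈-1 = k^h≈-1
  ... | inj₁ k^h≈1 = ⊥-elim (minimal h 0<h (≡.subst (h <_) (≡.sym n≡h+h) (m<m+n h 0<h)) k^h≈1)
    where
    0<h : 0 < h
    0<h = n≢0⇒n>0 (λ h≡0 → <⇒≢ 0<n (≡.sym (≡.trans n≡h+h (cong (λ x → x + x) h≡0))))

  Powers : (ℕ → Set) → ℕ → Set
  Powers J d = ∃[ j ] J j × d ≈ k ^ j

  Powers-resp-≈ : ∀ {J} → Powers J Respects _≈_
  Powers-resp-≈ d≈d' (j , Jj , d≈k^j) = j , Jj , ≡.trans (≡.sym d≈d') d≈k^j

  Powers⇒≉0 : ∀ {J d} → Powers J d → ¬ d ≈ 0
  Powers⇒≉0 (j , _ , d≈k^j) d≈0 = ^≉0 j (≡.trans (≡.sym d≈k^j) d≈0)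

  residue : ℕ → ℕ → ℕ
  residue v a = (v * k ^ a) % p

  IsMinExp : ℕ → ℕ → Set
  IsMinExp v a = a < n × (∀ b → b < n → residue v a ≤ residue v b)

  minExp : ℕ → ℕ
  minExp v = argmin (residue v) 0 (upTo n)

  minExp-isMinExp : ∀ v → IsMinExp v (minExp v)
  minExp-isMinExp v =
    argmin-all (residue v) {P = _< n} 0<n (All.tabulate ∈-upTo⁻) ,
    λ b b<n → All.lookup (f[argmin]≤f[xs] 0 (upTo n)) (∈-upTo⁺ b<n)

  isMinExp-unique : ∀ {v a b} → ¬ v ≈ 0 → IsMinExp v a → IsMinExp v b → a ≡ b
  isMinExp-unique {v} {a} {b} v≉0 (a<n , a-min) (b<n , b-min) with inverse v≉0
  ... | v' , v'v≈1 = ^-injective a<n b<n (*-cancelˡ {v} {v'} v'v≈1 (≤-antisym (a-min b b<n) (b-min a a<n)))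

  minExp-shift : ∀ {v w j} → ¬ w ≈ 0 → j ≤ n → v ≈ w * k ^ j → (j + minExp v) % n ≡ minExp w
  minExp-shift {v} {w} {j} w≉0 j≤n v≈wk^j =
    isMinExp-unique w≉0 (m%n<n (j + r) n , shifted-min) (minExp-isMinExp w)
    where
    open ≈-Reasoning
    r = minExp v

    w[j+r]≈vr : w * k ^ ((j + r) % n) ≈ v * k ^ r
    w[j+r]≈vr = begin
      w * k ^ ((j + r) % n)   ≈⟨ *-congˡ {w} (^-%n (j + r)) ⟨
      w * k ^ (j + r)         ≡⟨ *-^-+ w j r ⟨
      w * k ^ j * k ^ r       ≈⟨ *-congʳ v≈wk^j ⟨
      v * k ^ r               ∎

    v[b+n∸j]≈wb : ∀ b → v * k ^ ((b + (n ∸ j)) % n) ≈ w * k ^ b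
    v[b+n∸j]≈wb b = begin
      v * k ^ ((b + (n ∸ j)) % n)     ≈⟨ *-congˡ {v} (^-%n (b + (n ∸ j))) ⟨
      v * k ^ (b + (n ∸ j))           ≈⟨ *-congʳ v≈wk^j ⟩
      w * k ^ j * k ^ (b + (n ∸ j))   ≡⟨ *-^-+ w j (b + (n ∸ j)) ⟩
      w * k ^ (j + (b + (n ∸ j)))     ≡⟨ cong (λ e → w * k ^ e) (m+[n+[o∸m]]≡n+o j≤n) ⟩
      w * k ^ (b + n)                 ≈⟨ *-congˡ {w} (^-+n b) ⟩
      w * k ^ b                       ∎

    shifted-min : ∀ b → b < n → residue w ((j + r) % n) ≤ residue w b
    shifted-min b b<n = ≤-trans (≤-reflexive w[j+r]≈vr)
      (≤-trans (proj₂ (minExp-isMinExp v) _ (m%n<n (b + (n ∸ j)) n)) (≤-reflexive (v[b+n∸j]≈wb b)))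

record Tiling (n : ℕ) .{{_ : NonZero n}} (J R : ℕ → Set) : Set where
  field
    J-bounded : ∀ {j} → J j → j < n
    cover     : ∀ q → q < n → ∃₂ λ j r → J j × R r × r < n × (j + r) % n ≡ q
    unique    : ∀ {j j' r r'} → J j → J j' → R r → R r' → (j + r) % n ≡ (j' + r') % n → j ≡ j'

module FactorisationByTiling (p : ℕ) .{{_ : NonZero p}} (p-prime : Prime p)
                             (k n : ℕ) (order : IsMultOrder p k n) where

  open Residues p
  open PrimeResidues p p-prime
  open CyclicSubgroup p p-prime k n order

  module _ {J R : ℕ → Set} (R? : Decidable R) (tiling : Tiling n J R) where

    open Tiling tiling

    -- Without 0 < c the multiplier 0, whose factor has no edges, could qualify.
    IsMultiplier : ℕ → Set
    IsMultiplier c = 0 < c × R (minExp c)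

    isMultiplier? : Decidable IsMultiplier
    isMultiplier? c = (0 <? c) ×-dec R? (minExp c)

    multipliers : List ℕ
    multipliers = filter isMultiplier? (upTo p)

    exponent-shift : ∀ {w d c j} → w * d ≈ 1 → c * d ≈ k ^ j → J j → (j + minExp c) % n ≡ minExp w
    exponent-shift {w} {d} {c} {j} wd≈1 cd≈k^j Jj =
      minExp-shift (invertible⇒≉0 {d} dw≈1) (<⇒≤ (J-bounded Jj)) c≈wk^j
      where
      open ≈-Reasoning
      dw≈1 : d * w ≈ 1
      dw≈1 = ≡.trans (≡⇒≈ (*-comm d w)) wd≈1
      c≈wk^j : c ≈ w * k ^ j
      c≈wk^j = begin
        c              ≡⟨ *-identityʳ c ⟨
        c * 1          ≈⟨ *-congˡ {c} dw≈1 ⟨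
        c * (d * w)    ≡⟨ *-assoc c d w ⟨
        c * d * w      ≈⟨ *-congʳ cd≈k^j ⟩
        k ^ j * w      ≡⟨ *-comm (k ^ j) w ⟩
        w * k ^ j      ∎

    multiplier-unique : ∀ {w d c c'} → w * d ≈ 1 → c < p → c' < p → R (minExp c) → R (minExp c') →
                        Powers J (c * d) → Powers J (c' * d) → c ≡ c'
    multiplier-unique {w} {d} {c} {c'} wd≈1 c<p c'<p Rc Rc' (j , Jj , cd≈k^j) (j' , Jj' , c'd≈k^j') =
      ≈⇒≡ c<p c'<p (*-cancelˡ {d} {w} wd≈1 (begin
        d * c       ≡⟨ *-comm d c ⟩
        c * d       ≈⟨ cd≈k^j ⟩
        k ^ j       ≡⟨ cong (k ^_) j≡j' ⟩
        k ^ j'      ≈⟨ c'd≈k^j' ⟨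
        c' * d      ≡⟨ *-comm c' d ⟩
        d * c'      ∎))
      where
      open ≈-Reasoning
      j≡j' : j ≡ j'
      j≡j' = unique Jj Jj' Rc Rc' (≡.trans (exponent-shift {w} {d} {c} wd≈1 cd≈k^j Jj)
                                          (≡.sym (exponent-shift {w} {d} {c'} wd≈1 c'd≈k^j' Jj')))

    multiplier-exists : ∀ {w d} → w * d ≈ 1 → ∃[ c ] c < p × IsMultiplier c × Powers J (c * d)
    multiplier-exists {w} {d} wd≈1 with cover (minExp w) (proj₁ (minExp-isMinExp w))
    ... | j , r , Jj , Rr , r<n , [j+r]%n≡minExp-w =
      c , m%n<n (w * k ^ j) p , (0<c , ≡.subst R (≡.sym minExp-c≡r) Rr) , (j , Jj , cd≈k^j)
      where
      open ≈-Reasoning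
      c = (w * k ^ j) % p
      cd≈k^j : c * d ≈ k ^ j
      cd≈k^j = begin
        c * d              ≈⟨ *-congʳ (%-≈ (w * k ^ j)) ⟩
        w * k ^ j * d      ≡⟨ *-assoc w (k ^ j) d ⟩
        w * (k ^ j * d)    ≡⟨ cong (w *_) (*-comm (k ^ j) d) ⟩
        w * (d * k ^ j)    ≡⟨ *-assoc w d (k ^ j) ⟨
        w * d * k ^ j      ≈⟨ *-congʳ wd≈1 ⟩
        1 * k ^ j          ≡⟨ *-identityˡ (k ^ j) ⟩
        k ^ j              ∎
      0<c : 0 < c
      0<c = n≢0⇒n>0 λ c≡0 → Powers⇒≉0 {J} (j , Jj , cd≈k^j) (≡⇒≈ (cong (_* d) c≡0))
      minExp-c≡r : minExp c ≡ r
      minExp-c≡r = Residues.≈⇒≡ n (proj₁ (minExp-isMinExp c)) r<n (Residues.+-cancelˡ n j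
        (≡.trans (exponent-shift {w} {d} {c} wd≈1 cd≈k^j Jj) (≡.sym [j+r]%n≡minExp-w)))

    factorisation : Factorisation (K p) (Cay p (Powers J))
    factorisation = length multipliers , factor , factor⊆K , factor≅ , unique-factor
      where
      multiplier : Fin (length multipliers) → ℕ
      multiplier = lookup multipliers

      factor : Fin (length multipliers) → Graph (Fin p)
      factor i = Cay p (λ d → Powers J (multiplier i * d))

      multiplier∈ : ∀ i → multiplier i ∈ upTo p × IsMultiplier (multiplier i)
      multiplier∈ i = ∈-filter⁻ isMultiplier? {xs = upTo p} (∈-lookup {xs = multipliers} i)

      multiplier<p : ∀ i → multiplier i < p
      multiplier<p i = ∈-upTo⁻ (proj₁ (multiplier∈ i))

      isMultiplier : ∀ i → IsMultiplier (multiplier i)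
      isMultiplier i = proj₂ (multiplier∈ i)

      factor⊆K : ∀ i → factor i ⊆ᴳ K p
      factor⊆K i x .x Powers-c[x-x] refl = Powers⇒≉0 Powers-c[x-x]
        (≡.trans (*-congˡ {multiplier i} (diff-self x)) (≡⇒≈ (*-zeroʳ (multiplier i))))

      factor≅ : ∀ i → factor i ≅ Cay p (Powers J)
      factor≅ i = scale-≅ {multiplier i} {proj₁ c⁻¹} (proj₂ c⁻¹) Powers-resp-≈
        where
        c⁻¹ : ∃[ c' ] c' * multiplier i ≈ 1
        c⁻¹ = inverse (0<a<p⇒≉0 (proj₁ (isMultiplier i)) (multiplier<p i))

      factor-index : ∀ {w} x y → w * diff p x y ≈ 1 →
                     ∃[ c ] c < p × IsMultiplier c × Powers J (c * diff p x y) →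
                     ∃[ i ] (factor i x y × (∀ j → factor j x y → j ≡ i))
      factor-index {w} x y wd≈1 (c , c<p , isMultiplier-c , Powers-cd) =
        index c∈ , ≡.subst (λ c → Powers J (c * diff p x y)) c≡multiplier Powers-cd , only
        where
        c∈ = ∈-filter⁺ isMultiplier? (∈-upTo⁺ c<p) isMultiplier-c
        c≡multiplier : c ≡ multiplier (index c∈)
        c≡multiplier = lookup-index c∈
        only : ∀ j → factor j x y → j ≡ index c∈
        only j Powers-c'd = lookup-injective (filter⁺ isMultiplier? (upTo⁺ p)) j (index c∈) (≡.trans
          (multiplier-unique {w} wd≈1 (multiplier<p j) c<p (proj₂ (isMultiplier j)) (proj₂ isMultiplier-c)
             Powers-c'd Powers-cd)
          c≡multiplier)

      unique-factor : ∀ x y → K p x y → ∃[ i ] (factor i x y × (∀ j → factor j x y → j ≡ i))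
      unique-factor x y x≢y = factor-index {w} x y wd≈1 (multiplier-exists {w} wd≈1)
        where
        d⁻¹ : ∃[ w ] w * diff p x y ≈ 1
        d⁻¹ = inverse (x≢y ∘ diff≈0⇒≡ x y)
        w = proj₁ d⁻¹
        wd≈1 = proj₂ d⁻¹

digits-unique : ∀ {d a a' x x'} .{{_ : NonZero d}} → a < d → a' < d →
                a + x * d ≡ a' + x' * d → a ≡ a' × x ≡ x'
digits-unique {d} {a} {a'} {x} {x'} a<d a'<d eq =
  a≡a' , *-cancelʳ-≡ x x' d (+-cancelˡ-≡ a _ _ (≡.trans eq (cong (_+ x' * d) (≡.sym a≡a'))))
  where
  open ≡.≡-Reasoning
  a≡a' : a ≡ a'
  a≡a' = begin
    a                  ≡⟨ m<n⇒m%n≡m a<d ⟨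
    a % d              ≡⟨ [m+kn]%n≡m%n a x d ⟨
    (a + x * d) % d    ≡⟨ cong (_% d) eq ⟩
    (a' + x' * d) % d  ≡⟨ [m+kn]%n≡m%n a' x' d ⟩
    a' % d             ≡⟨ m<n⇒m%n≡m a'<d ⟩
    a'                 ∎

digits-< : ∀ {d a x m} → a < d → x < m → a + x * d < m * d
digits-< {d} {a} {x} a<d x<m = <-≤-trans (+-monoˡ-< (x * d) a<d) (*-monoˡ-≤ d x<m)

-- ℤ_{4t} = {0, 1, 2t, 2t + 1} + {0, 2, …, 2t − 2} is the mixed-radix expansion
-- q = e + 2 (s + t f) with digits e < 2, s < t, f < 2.
module DigitTiling (t : ℕ) .{{_ : NonZero t}} where

  instance
    4t-nonZero : NonZero (t * 4)
    4t-nonZero = m*n≢0 t 4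

  J : ℕ → Set
  J j = ∃₂ λ e f → e < 2 × f < 2 × j ≡ e + f * (t * 2)

  R : ℕ → Set
  R r = r % 2 ≡ 0 × r < t * 2

  R? : Decidable R
  R? r = (r % 2 ≟ 0) ×-dec (r <? t * 2)

  private
    regroup : ∀ e f s → e + f * (t * 2) + s * 2 ≡ e + (s + f * t) * 2
    regroup = regroup-digits t

  R⇒even : ∀ {r} → R r → ∃[ s ] s < t × r ≡ s * 2
  R⇒even {r} (r%2≡0 , r<2t) =
    r / 2 , m<n*o⇒m/o<n r<2t , ≡.trans (m≡m%n+[m/n]*n r 2) (cong (_+ r / 2 * 2) r%2≡0)

  J+R<n : ∀ {j r} → J j → R r → j + r < t * 4
  J+R<n (e , f , e<2 , f<2 , refl) Rr with R⇒even Rr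
  ... | s , s<t , refl =
    ≡.subst₂ _<_ (≡.sym (regroup e f s)) (≡.sym (4t≡[2t]2 t)) (digits-< e<2 (digits-< s<t f<2))

  tiling : Tiling (t * 4) J R
  tiling = record { J-bounded = J-bounded ; cover = cover ; unique = unique }
    where
    J-bounded : ∀ {j} → J j → j < t * 4
    J-bounded {j} Jj = ≤-<-trans (m≤m+n j 0) (J+R<n Jj (refl , *-monoˡ-< 2 (>-nonZero⁻¹ t)))

    cover : ∀ q → q < t * 4 → ∃₂ λ j r → J j × R r × r < t * 4 × (j + r) % (t * 4) ≡ q
    cover q q<4t = e + f * (t * 2) , s * 2 , (e , f , m%n<n q 2 , f<2 , refl) ,
      (m*n%n≡0 s 2 , *-monoˡ-< 2 s<t) , <-≤-trans (*-monoˡ-< 2 s<t) (*-monoʳ-≤ t (s≤s (s≤s z≤n))) ,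
      ≡.trans (m<n⇒m%n≡m (≡.subst (_< t * 4) (≡.sym j+r≡q) q<4t)) j+r≡q
      where
      open ≡.≡-Reasoning
      e = q % 2
      y = q / 2
      f = y / t
      s = y % t
      s<t : s < t
      s<t = m%n<n y t
      y<2t : y < 2 * t
      y<2t = m<n*o⇒m/o<n (≡.subst (q <_) (4t≡[2t]2 t) q<4t)
      f<2 : f < 2
      f<2 = m<n*o⇒m/o<n y<2t
      j+r≡q : e + f * (t * 2) + s * 2 ≡ q
      j+r≡q = begin
        e + f * (t * 2) + s * 2   ≡⟨ regroup e f s ⟩
        e + (s + f * t) * 2       ≡⟨ cong (λ z → e + z * 2) (m≡m%n+[m/n]*n y t) ⟨
        e + y * 2                 ≡⟨ m≡m%n+[m/n]*n q 2 ⟨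
        q                         ∎

    unique : ∀ {j j' r r'} → J j → J j' → R r → R r' →
             (j + r) % (t * 4) ≡ (j' + r') % (t * 4) → j ≡ j'
    unique Jj@(e , f , e<2 , _ , refl) Jj'@(e' , f' , e'<2 , _ , refl) Rr Rr' eq
      with R⇒even Rr | R⇒even Rr'
    ... | s , s<t , refl | s' , s'<t , refl = cong₂ (λ e f → e + f * (t * 2)) e≡e' f≡f'
      where
      j+r≡j'+r' : e + f * (t * 2) + s * 2 ≡ e' + f' * (t * 2) + s' * 2
      j+r≡j'+r' = ≡.trans (≡.sym (m<n⇒m%n≡m (J+R<n Jj Rr))) (≡.trans eq (m<n⇒m%n≡m (J+R<n Jj' Rr')))
      e≡e'×y≡y' : e ≡ e' × s + f * t ≡ s' + f' * t
      e≡e'×y≡y' = digits-unique e<2 e'<2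
        (≡.trans (≡.sym (regroup e f s)) (≡.trans j+r≡j'+r' (regroup e' f' s')))
      e≡e' : e ≡ e'
      e≡e' = proj₁ e≡e'×y≡y'
      f≡f' : f ≡ f'
      f≡f' = proj₂ (digits-unique s<t s'<t (proj₂ e≡e'×y≡y'))

Factorisation-resp-⇔ : ∀ {V W} {G : Graph V} {H H' : Graph W} →
                       (∀ x y → H x y ⇔ H' x y) → Factorisation G H → Factorisation G H'
Factorisation-resp-⇔ H⇔H' (m , E , E⊆G , E≅H , cover) =
  m , E , E⊆G , (λ i → Product.map₂ (λ f-iso x y → ⇔-trans (f-iso x y) (H⇔H' _ _)) (E≅H i)) , cover

module PlusMinusOneK (p : ℕ) .{{_ : NonZero p}} (p-prime : Prime p)
                     (k t : ℕ) .{{_ : NonZero t}} (order : IsMultOrder p k (t * 4)) where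

  open Residues p
  open CyclicSubgroup p p-prime k (t * 4) order
  open DigitTiling t

  k^2t≈-1 : k ^ (t * 2) ≈ neg 1
  k^2t≈-1 = ^-half≈-1 (t * 2) (4t≡2t+2t t)

  k^[1+2t]≈-k : k ^ (1 + t * 2) ≈ neg k
  k^[1+2t]≈-k = begin
    k * k ^ (t * 2)    ≈⟨ *-congˡ {k} k^2t≈-1 ⟩
    k * neg 1          ≡⟨ *-comm k (neg 1) ⟩
    neg 1 * k          ≈⟨ neg-*ˡ 1 k ⟩
    neg (1 * k)        ≡⟨ cong neg (*-identityˡ k) ⟩
    neg k              ∎
    where open ≈-Reasoning

  Powers-J⇔±1±k : ∀ {d} → d < p → Powers J d ⇔ pm2 p 1 k d
  Powers-J⇔±1±k {d} d<p = mk⇔ to from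
    where
    ≈⇒≡% : ∀ {a} → d ≈ a → d ≡ a % p
    ≈⇒≡% = Equivalence.from (≡%⇔≈ d<p)
    ≡%⇒≈ : ∀ {a} → d ≡ a % p → d ≈ a
    ≡%⇒≈ = Equivalence.to (≡%⇔≈ d<p)
    k^[e+1*2t]≡k^[e+2t] : ∀ e → k ^ (e + 1 * (t * 2)) ≡ k ^ (e + t * 2)
    k^[e+1*2t]≡k^[e+2t] e = cong (λ f → k ^ (e + f)) (*-identityˡ (t * 2))

    to : Powers J d → pm2 p 1 k d
    to (_ , (0 , 0 , _ , _ , refl) , d≈1)  = inj₁ (≈⇒≡% d≈1)
    to (_ , (0 , 1 , _ , _ , refl) , d≈k^j) =
      inj₂ (inj₁ (≈⇒≡% (≡.trans d≈k^j (≡.trans (≡⇒≈ (k^[e+1*2t]≡k^[e+2t] 0)) k^2t≈-1))))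
    to (_ , (1 , 0 , _ , _ , refl) , d≈k*1) =
      inj₂ (inj₂ (inj₁ (≈⇒≡% (≡.trans d≈k*1 (≡⇒≈ (*-identityʳ k))))))
    to (_ , (1 , 1 , _ , _ , refl) , d≈k^j) =
      inj₂ (inj₂ (inj₂ (≈⇒≡% (≡.trans d≈k^j (≡.trans (≡⇒≈ (k^[e+1*2t]≡k^[e+2t] 1)) k^[1+2t]≈-k)))))
    to (_ , (suc (suc _) , _ , s≤s (s≤s ()) , _ , _) , _)
    to (_ , (_ , suc (suc _) , _ , s≤s (s≤s ()) , _) , _)

    from : pm2 p 1 k d → Powers J d
    from (inj₁ d≡1%p) = 0 , (0 , 0 , z<s , z<s , refl) , ≡%⇒≈ d≡1%p
    from (inj₂ (inj₁ d≡-1%p)) = 0 + 1 * (t * 2) , (0 , 1 , z<s , s<s z<s , refl) ,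
      ≡.trans (≡%⇒≈ d≡-1%p) (≡.trans (≡.sym k^2t≈-1) (≡⇒≈ (≡.sym (k^[e+1*2t]≡k^[e+2t] 0))))
    from (inj₂ (inj₂ (inj₁ d≡k%p))) = 1 , (1 , 0 , s<s z<s , z<s , refl) ,
      ≡.trans (≡%⇒≈ d≡k%p) (≡⇒≈ (≡.sym (*-identityʳ k)))
    from (inj₂ (inj₂ (inj₂ d≡-k%p))) = 1 + 1 * (t * 2) , (1 , 1 , s<s z<s , s<s z<s , refl) ,
      ≡.trans (≡%⇒≈ d≡-k%p) (≡.trans (≡.sym k^[1+2t]≈-k) (≡⇒≈ (≡.sym (k^[e+1*2t]≡k^[e+2t] 1))))

  factorisation : Factorisation (K p) (Cay p (pm2 p 1 k))
  factorisation = Factorisation-resp-⇔ (λ x y → Powers-J⇔±1±k (diff<p x y))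
    (FactorisationByTiling.factorisation p p-prime k (t * 4) order R? tiling)

theorem2 : (p : ℕ) → .{{_ : NonZero p}} → Prime p → p % 4 ≡ 1 → (k ord : ℕ) →
    IsMultOrder p k ord → 4 ∣ ord → Factorisation (K p) (Cay p (pm2 p 1 k))
theorem2 p p-prime _ k ord order (divides t refl) = PlusMinusOneK.factorisation p p-prime k t order
  where
  instance
    t-nonZero : NonZero t
    t-nonZero = m*n≢0⇒m≢0 t {{>-nonZero (proj₁ order)}}
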